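{- Let $D=(V,A)$ be a digraph and let $f$ be a minimal MODF of $D$. Then for every $v\in V$ with $f(v)=1$ there exists $u\in N^-[v]$ such that $f(N^+[u])\in\{1,2\}$.
   Context: Digraphs are finite, without loops or multiple arcs (pairs of opposite arcs allowed). For $u\in V$, $N^+[u]=\{u\}\cup\{v: uv\in A\}$ and $N^-[u]=\{u\}\cup\{v: vu\in A\}$. For $f:V\to\{ -1,1\}$ and $X\subseteq V$, $f(X)=\sum_{v\in X}f(v)$. A majority out-dominating function (MODF) of $D$ is a function $f:V\to\{ -1,1\}$ with $|\{v\in V: f(N^+[v])\geq1\}|\geq |V|/2$. A MODF $f$ is minimal if there is no MODF $g\neq f$ of $D$ with $g(v)\leq f(v)$ for every $v\in V$. -}

module Defs where

open import Data.Nat using (ℕ; _≤_; _*_)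
open import Data.Integer using (ℤ; _+_; 0ℤ; 1ℤ; -1ℤ) renaming (_≤_ to _≤ℤ_; _≤?_ to _≤ℤ?_)
open import Data.Fin using (Fin)
open import Data.Bool using (Bool; true; false; if_then_else_)
open import Data.List using (List; length; filter; map; foldr; allFin)
open import Data.Sum using (_⊎_)
open import Data.Product using (_×_)
open import Relation.Binary.PropositionalEquality using (_≡_)
open import Relation.Nullary using (¬_)

-- A digraph on vertex set Fin n: arc u v ≡ true iff uv ∈ A.
-- Loopless; a single Bool per ordered pair excludes multiple arcs,
-- while opposite arcs uv, vu are allowed.
record Digraph : Set where
  field
    n        : ℕ
    arc      : Fin n → Fin n → Bool
    loopless : ∀ v → arc v v ≡ false
open Digraph public

-- f(N⁺[u]) = f(u) + Σ_{v : uv ∈ A} f(v)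
outSum : (D : Digraph) → (Fin (n D) → ℤ) → Fin (n D) → ℤ
outSum D f u = f u + foldr _+_ 0ℤ (map (λ v → if arc D u v then f v else 0ℤ) (allFin (n D)))

IsPM : (D : Digraph) → (Fin (n D) → ℤ) → Set
IsPM D f = ∀ v → f v ≡ 1ℤ ⊎ f v ≡ -1ℤ

goodCount : (D : Digraph) → (Fin (n D) → ℤ) → ℕ
goodCount D f = length (filter (λ v → 1ℤ ≤ℤ? outSum D f v) (allFin (n D)))

IsMODF : (D : Digraph) → (Fin (n D) → ℤ) → Set
IsMODF D f = IsPM D f × (n D ≤ 2 * goodCount D f)

IsMinimalMODF : (D : Digraph) → (Fin (n D) → ℤ) → Set
IsMinimalMODF D f =
  IsMODF D f ×
  ((g : Fin (n D) → ℤ) → IsMODF D g → (∀ v → g v ≤ℤ f v) → ∀ v → g v ≡ f v)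

InNMinus : (D : Digraph) → Fin (n D) → Fin (n D) → Set
InNMinus D u v = u ≡ v ⊎ arc D u v ≡ true

module Submission where

-- Let f be a minimal MODF and f(v) = 1, and
-- suppose no u ∈ N⁻[v] has f(N⁺[u]) ∈ {1,2}.  Lower f at v to obtain
-- g = f[v ↦ -1].  Exactly the closed out-neighbourhoods N⁺[u] with
-- u ∈ N⁻[v] contain v, so g(N⁺[u]) = f(N⁺[u]) - 2 for those u and
-- g(N⁺[u]) = f(N⁺[u]) otherwise.  A vertex u ∈ N⁻[v] that is good for f
-- (f(N⁺[u]) ≥ 1) has f(N⁺[u]) ≥ 3 by assumption, hence stays good for g;
-- so g has at least as many good vertices as f and is again an MODF.  As
-- g ≤ f and g ≠ f, this contradicts minimality.

open import Defs
open import Data.Fin using (Fin)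
open import Data.Integer using (ℤ; 1ℤ; +_)
open import Data.Sum using (_⊎_)
open import Data.Product using (_×_; ∃-syntax)
open import Relation.Binary.PropositionalEquality using (_≡_)

open import Data.Nat as ℕ using (zero; suc)
import Data.Nat.Properties as ℕP
open import Data.Integer as ℤ using (0ℤ; -1ℤ; -[1+_]; _+_) renaming (_≤_ to _≤ℤ_; _≤?_ to _≤ℤ?_)
import Data.Integer.Properties as ℤP
open import Algebra.Properties.CommutativeSemigroup ℤP.+-commutativeSemigroup using (xy∙z≈xz∙y)
open import Data.Fin.Properties using (any?; suc-injective) renaming (_≟_ to _≟F_)
open import Data.Bool using (Bool; true; false; if_then_else_) renaming (_≟_ to _≟B_)
open import Data.List using (foldr; tabulate; allFin)
open import Data.List.Properties using (map-tabulate)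
open import Data.List.Relation.Binary.Sublist.Propositional using (⊆-refl)
open import Data.List.Relation.Binary.Sublist.Propositional.Properties using (filter⁺; length-mono-≤)
open import Data.Sum using (inj₁; inj₂)
open import Data.Product using (_,_)
open import Relation.Binary.PropositionalEquality using (refl; sym; trans; cong; cong₂; subst; _≢_; module ≡-Reasoning)
open import Relation.Nullary using (Dec; yes; no; ¬_)
open import Relation.Nullary.Decidable using (_⊎-dec_; _×-dec_)
open import Data.Empty using (⊥-elim)

Σ : ∀ {m} → (Fin m → ℤ) → ℤ
Σ a = foldr _+_ 0ℤ (tabulate a)

Σ-cong : ∀ {m} {a b : Fin m → ℤ} → (∀ w → a w ≡ b w) → Σ a ≡ Σ b
Σ-cong {zero}  eq = refl
Σ-cong {suc m} eq = cong₂ _+_ (eq Fin.zero) (Σ-cong (λ w → eq (Fin.suc w)))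

Σ-pointShift : ∀ {m} (v : Fin m) (a b : Fin m → ℤ) (d : ℤ) →
  (∀ w → w ≢ v → a w ≡ b w) → a v ≡ b v + d → Σ a ≡ Σ b + d
Σ-pointShift {suc m} Fin.zero a b d agree atV = begin
    a Fin.zero + Σ (λ w → a (Fin.suc w))
  ≡⟨ cong₂ _+_ atV (Σ-cong (λ w → agree (Fin.suc w) λ ())) ⟩
    (b Fin.zero + d) + Σ (λ w → b (Fin.suc w))
  ≡⟨ xy∙z≈xz∙y (b Fin.zero) d _ ⟩
    Σ b + d
  ∎
  where open ≡-Reasoning
Σ-pointShift {suc m} (Fin.suc v) a b d agree atV = begin
    a Fin.zero + Σ (λ w → a (Fin.suc w))
  ≡⟨ cong₂ _+_ (agree Fin.zero λ ()) (Σ-pointShift v _ _ d agreeTail atV) ⟩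
    b Fin.zero + (Σ (λ w → b (Fin.suc w)) + d)
  ≡⟨ sym (ℤP.+-assoc (b Fin.zero) _ d) ⟩
    Σ b + d
  ∎
  where
  open ≡-Reasoning
  agreeTail : ∀ w → w ≢ v → a (Fin.suc w) ≡ b (Fin.suc w)
  agreeTail w w≢v = agree (Fin.suc w) (λ eq → w≢v (suc-injective eq))

masked : Bool → ℤ → ℤ
masked b x = if b then x else 0ℤ

masked-+ : ∀ b x d → masked b (x + d) ≡ masked b x + masked b d
masked-+ true  x d = refl
masked-+ false x d = refl

nbrSum : (D : Digraph) → (Fin (n D) → ℤ) → Fin (n D) → ℤ
nbrSum D f u = Σ (λ w → masked (arc D u w) (f w))

outSum≡ : (D : Digraph) (f : Fin (n D) → ℤ) (u : Fin (n D)) →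
  outSum D f u ≡ f u + nbrSum D f u
outSum≡ D f u =
  cong (λ xs → f u + foldr _+_ 0ℤ xs) (map-tabulate (λ w → w) (λ w → masked (arc D u w) (f w)))

inNMinus? : (D : Digraph) (u v : Fin (n D)) → Dec (InNMinus D u v)
inNMinus? D u v = (u ≟F v) ⊎-dec (arc D u v ≟B true)

module PointChange (D : Digraph) (f g : Fin (n D) → ℤ) (v : Fin (n D)) (d : ℤ)
  (agree : ∀ w → w ≢ v → f w ≡ g w) (atV : f v ≡ g v + d) where

  nbrSum-shift : ∀ u → nbrSum D f u ≡ nbrSum D g u + masked (arc D u v) d
  nbrSum-shift u = Σ-pointShift v _ _ _ maskedAgree
    (trans (cong (masked (arc D u v)) atV) (masked-+ (arc D u v) (g v) d))
    where
    maskedAgree : ∀ w → w ≢ v → masked (arc D u w) (f w) ≡ masked (arc D u w) (g w)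
    maskedAgree w w≢v = cong (masked (arc D u w)) (agree w w≢v)

  outSum-inNeighbour : ∀ u → InNMinus D u v → outSum D f u ≡ outSum D g u + d
  outSum-inNeighbour u u∈N⁻ with u ≟F v
  ... | yes refl = begin
      outSum D f v                              ≡⟨ outSum≡ D f v ⟩
      f v + nbrSum D f v                        ≡⟨ cong₂ _+_ atV (nbrSum-shift v) ⟩
      (g v + d) + (nbrSum D g v + masked (arc D v v) d)
        ≡⟨ cong (λ b → (g v + d) + (nbrSum D g v + masked b d)) (loopless D v) ⟩
      (g v + d) + (nbrSum D g v + 0ℤ)           ≡⟨ cong (λ x → (g v + d) + x) (ℤP.+-identityʳ _) ⟩
      (g v + d) + nbrSum D g v                  ≡⟨ xy∙z≈xz∙y (g v) d _ ⟩
      (g v + nbrSum D g v) + d                  ≡⟨ cong (_+ d) (outSum≡ D g v) ⟨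
      outSum D g v + d                          ∎
    where open ≡-Reasoning
  ... | no u≢v = begin
      outSum D f u                              ≡⟨ outSum≡ D f u ⟩
      f u + nbrSum D f u                        ≡⟨ cong₂ _+_ (agree u u≢v) (nbrSum-shift u) ⟩
      g u + (nbrSum D g u + masked (arc D u v) d)
        ≡⟨ cong (λ b → g u + (nbrSum D g u + masked b d)) (arcToV u∈N⁻) ⟩
      g u + (nbrSum D g u + d)                  ≡⟨ ℤP.+-assoc (g u) _ d ⟨
      (g u + nbrSum D g u) + d                  ≡⟨ cong (_+ d) (outSum≡ D g u) ⟨
      outSum D g u + d                          ∎
    where
    open ≡-Reasoning
    arcToV : InNMinus D u v → arc D u v ≡ true
    arcToV (inj₁ u≡v) = ⊥-elim (u≢v u≡v)
    arcToV (inj₂ uv)  = uv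

  outSum-outside : ∀ u → ¬ InNMinus D u v → outSum D f u ≡ outSum D g u
  outSum-outside u u∉N⁻ = begin
      outSum D f u                              ≡⟨ outSum≡ D f u ⟩
      f u + nbrSum D f u                        ≡⟨ cong₂ _+_ (agree u (λ u≡v → u∉N⁻ (inj₁ u≡v))) (nbrSum-shift u) ⟩
      g u + (nbrSum D g u + masked (arc D u v) d)
        ≡⟨ cong (λ b → g u + (nbrSum D g u + masked b d)) (noArcToV (arc D u v) refl) ⟩
      g u + (nbrSum D g u + 0ℤ)                 ≡⟨ cong (λ x → g u + x) (ℤP.+-identityʳ _) ⟩
      g u + nbrSum D g u                        ≡⟨ outSum≡ D g u ⟨
      outSum D g u                              ∎
    where
    open ≡-Reasoning
    noArcToV : ∀ b → arc D u v ≡ b → b ≡ false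
    noArcToV true  uv = ⊥-elim (u∉N⁻ (inj₂ uv))
    noArcToV false _  = refl

goodCount-mono : (D : Digraph) (f g : Fin (n D) → ℤ) →
  (∀ u → 1ℤ ≤ℤ outSum D f u → 1ℤ ≤ℤ outSum D g u) → goodCount D f ℕ.≤ goodCount D g
goodCount-mono D f g good⇒good =
  length-mono-≤ (filter⁺ (λ u → 1ℤ ≤ℤ? outSum D f u) (λ u → 1ℤ ≤ℤ? outSum D g u)
                         (λ { refl → good⇒good _ }) (⊆-refl {x = allFin (n D)}))

dropTwo : ∀ {x} (y : ℤ) → x ≡ y + + 2 → 1ℤ ≤ℤ x → ¬ (x ≡ + 1 ⊎ x ≡ + 2) → 1ℤ ≤ℤ y
dropTwo (+ zero)             refl _          not12 = ⊥-elim (not12 (inj₂ refl))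
dropTwo (+ suc k)            refl _          _     = ℤ.+≤+ (ℕ.s≤s ℕ.z≤n)
dropTwo -[1+ zero ]          refl _          not12 = ⊥-elim (not12 (inj₁ refl))
dropTwo -[1+ suc zero ]      refl (ℤ.+≤+ ()) _
dropTwo -[1+ suc (suc k) ]   refl ()         _

lowerAt : ∀ {m} → (Fin m → ℤ) → Fin m → Fin m → ℤ
lowerAt f v w with w ≟F v
... | yes _ = -1ℤ
... | no  _ = f w

lowerAt-self : ∀ {m} (f : Fin m → ℤ) v → lowerAt f v v ≡ -1ℤ
lowerAt-self f v with v ≟F v
... | yes _   = refl
... | no v≢v  = ⊥-elim (v≢v refl)

lowerAt-other : ∀ {m} (f : Fin m → ℤ) v w → w ≢ v → f w ≡ lowerAt f v w
lowerAt-other f v w w≢v with w ≟F v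
... | yes w≡v = ⊥-elim (w≢v w≡v)
... | no  _   = refl

lowerAt-PM : (D : Digraph) (f : Fin (n D) → ℤ) (v : Fin (n D)) → IsPM D f → IsPM D (lowerAt f v)
lowerAt-PM D f v pm w with w ≟F v
... | yes _ = inj₂ refl
... | no  _ = pm w

lowerAt-≤ : (D : Digraph) (f : Fin (n D) → ℤ) (v : Fin (n D)) → IsPM D f → ∀ w → lowerAt f v w ≤ℤ f w
lowerAt-≤ D f v pm w with w ≟F v | pm w
... | yes _ | inj₁ fw≡1  rewrite fw≡1  = ℤ.-≤+
... | yes _ | inj₂ fw≡-1 rewrite fw≡-1 = ℤP.≤-refl
... | no  _ | _ = ℤP.≤-refl

lowerAt-MODF : (D : Digraph) (f : Fin (n D) → ℤ) (v : Fin (n D)) →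
  IsMODF D f → f v ≡ 1ℤ →
  (∀ u → InNMinus D u v → ¬ (outSum D f u ≡ + 1 ⊎ outSum D f u ≡ + 2)) →
  IsMODF D (lowerAt f v)
lowerAt-MODF D f v (pm , majority) fv≡1 no12 =
  lowerAt-PM D f v pm ,
  ℕP.≤-trans majority (ℕP.*-monoʳ-≤ 2 (goodCount-mono D f g staysGood))
  where
  g : Fin (n D) → ℤ
  g = lowerAt f v

  open PointChange D f g v (+ 2) (lowerAt-other f v)
    (trans fv≡1 (sym (cong (λ x → x + + 2) (lowerAt-self f v))))

  staysGood : ∀ u → 1ℤ ≤ℤ outSum D f u → 1ℤ ≤ℤ outSum D g u
  staysGood u good with inNMinus? D u v
  ... | yes u∈N⁻ = dropTwo (outSum D g u) (outSum-inNeighbour u u∈N⁻) good (no12 u u∈N⁻)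
  ... | no  u∉N⁻ = subst (1ℤ ≤ℤ_) (outSum-outside u u∉N⁻) good

proposition3p7 : (D : Digraph) (f : Fin (n D) → ℤ) → IsMinimalMODF D f →
    (v : Fin (n D)) → f v ≡ 1ℤ →
    ∃[ u ] (InNMinus D u v × (outSum D f u ≡ + 1 ⊎ outSum D f u ≡ + 2))
proposition3p7 D f (modf@(pm , _) , minimal) v fv≡1 with any? witness?
  where
  witness? : ∀ u → Dec (InNMinus D u v × (outSum D f u ≡ + 1 ⊎ outSum D f u ≡ + 2))
  witness? u = inNMinus? D u v
          ×-dec ((outSum D f u ℤ.≟ + 1) ⊎-dec (outSum D f u ℤ.≟ + 2))
... | yes found = found
... | no  none  = ⊥-elim (-1≢1 (begin
      -1ℤ             ≡⟨ lowerAt-self f v ⟨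
      lowerAt f v v   ≡⟨ minimal (lowerAt f v) lowerMODF (lowerAt-≤ D f v pm) v ⟩
      f v             ≡⟨ fv≡1 ⟩
      1ℤ              ∎))
  where
  open ≡-Reasoning
  -1≢1 : -1ℤ ≢ 1ℤ
  -1≢1 ()
  lowerMODF : IsMODF D (lowerAt f v)
  lowerMODF = lowerAt-MODF D f v modf fv≡1 (λ u u∈N⁻ in12 → none (u , u∈N⁻ , in12))
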